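{- Let $\mathcal{H}=(V,E)$ be a cycle-free $3$-uniform hypergraph. Then: (1) for all distinct $u,v\in V$ there are majority $2$-colourings $\gamma_1,\gamma_2,\gamma_3$ of $\mathcal{H}$ with $\{(\gamma_i(u),\gamma_i(v))\mid i=1,2,3\}=\{(1,1),(0,1),(1,0)\}$; (2) for all distinct $u,v\in V$ such that no hyperedge contains $\{u,v\}$, there is a majority $2$-colouring $\gamma$ with $(\gamma(u),\gamma(v))=(0,0)$. Consequently $M_\mathcal{H}\in\mathbb{B}_2^1$.
   Context: A cycle in a hypergraph is a sequence $v_0,e_0,\dots,v_{n-1},e_{n-1}$ ($n\ge 2$) of pairwise distinct vertices and pairwise distinct hyperedges with $v_{i+1}\in e_i\cap e_{i+1}$ (indices mod $n$); cycle-free means there is none. Hypergraphs have no isolated vertices. A majority $2$-colouring is a map $\gamma:V\to\{0,1\}$ such that every hyperedge has exactly two vertices of colour $1$ and one of colour $0$. $\mathbb{B}_2^1$ is the monoid variety generated by ${\bf B}_2^1=\langle \mathsf{a},\mathsf{b}\mid \mathsf{a}\mathsf{b}\mathsf{a}=\mathsf{a},\ \mathsf{b}\mathsf{a}\mathsf{b}=\mathsf{b},\ \mathsf{a}\mathsf{a}=\mathsf{b}\mathsf{b}=0\rangle$. For $2$-subsets of $V$, $\{u,v\}\equiv\{x,y\}$ iff there is $w$ with $\{u,v,w\},\{x,y,w\}\in E$, or neither is contained in a hyperedge. $M_\mathcal{H}$ is the monoid with identity $1$ generated by a zero $0$, an element $\mathsf{t}$ and the elements of $V$ subject to: $\mathsf{t}^2=\mathsf{t}u\mathsf{t}=\mathsf{t}uv\mathsf{t}=0$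 ($u,v\in V$); $uv=vu$; $uu=0$; $uv=0$ whenever no hyperedge contains $\{u,v\}$; $\mathsf{t}uvw\mathsf{t}=\mathsf{t}$ for $\{u,v,w\}\in E$; $uvw=u'v'w'$ for all $\{u,v,w\},\{u',v',w'\}\in E$ (this element is $\mathsf{e}$); $\mathsf{e}\mathsf{t}\mathsf{e}=\mathsf{e}$; and $uv=u'v'$ whenever $\{u,v\}\equiv\{u',v'\}$. -}

module Defs where

open import Data.Nat using (ℕ; zero; suc; _≤_)
open import Data.Nat.DivMod using (_%_; m%n<n)
open import Data.Fin using (Fin; toℕ; fromℕ<)
open import Data.Bool using (Bool; true; false)
open import Data.List using (List; []; _∷_; _++_; concatMap)
open import Data.Product using (Σ; _×_; _,_; ∃)
open import Data.Sum using (_⊎_)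
open import Data.Empty using (⊥)
open import Relation.Nullary using (¬_)
open import Relation.Binary.PropositionalEquality using (_≡_)
open import Function.Definitions using (Injective)

_⟺_ : Set → Set → Set
A ⟺ B = (A → B) × (B → A)

record Hypergraph3 : Set where
  field
    n        : ℕ
    m        : ℕ
    edge     : Fin m → Fin 3 → Fin n
    edge-inj : ∀ e → Injective _≡_ _≡_ (edge e)

  _∈ₑ_ : Fin n → Fin m → Set
  v ∈ₑ e = Σ (Fin 3) λ j → edge e j ≡ v

  field
    edges-distinct : ∀ e e' → (∀ z → (z ∈ₑ e) ⟺ (z ∈ₑ e')) → e ≡ e'
    no-isolated    : ∀ v → Σ (Fin m) λ e → v ∈ₑ e

  IsEdge : Fin n → Fin n → Fin n → Set
  IsEdge u v w = Σ (Fin m) λ e → ∀ z → (z ∈ₑ e) ⟺ (z ≡ u ⊎ (z ≡ v ⊎ z ≡ w))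

  PairInEdge : Fin n → Fin n → Set
  PairInEdge u v = Σ (Fin m) λ e → (u ∈ₑ e) × (v ∈ₑ e)

open Hypergraph3 public

next : ∀ {k} → Fin (suc k) → Fin (suc k)
next {k} i = fromℕ< (m%n<n (suc (toℕ i)) (suc k))

-- A cycle of length k+2: vertices v_0..v_{k+1}, edges e_0..e_{k+1},
-- pairwise distinct, with v_{i+1} ∈ e_i ∩ e_{i+1} (indices mod k+2).
record Cycle (H : Hypergraph3) (k : ℕ) : Set where
  field
    vs     : Fin (suc (suc k)) → Fin (n H)
    es     : Fin (suc (suc k)) → Fin (m H)
    vs-inj : Injective _≡_ _≡_ vs
    es-inj : Injective _≡_ _≡_ es
    link₁  : ∀ i → _∈ₑ_ H (vs (next i)) (es i)
    link₂  : ∀ i → _∈ₑ_ H (vs (next i)) (es (next i))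

CycleFree : Hypergraph3 → Set
CycleFree H = ∀ k → ¬ Cycle H k

-- Majority 2-colourings (true = colour 1, false = colour 0).

b2n : Bool → ℕ
b2n true  = 1
b2n false = 0

ones : ∀ (H : Hypergraph3) → (Fin (n H) → Bool) → Fin (m H) → ℕ
ones H γ e = b2n (γ (edge H e Fin.zero))
           Data.Nat.+ (b2n (γ (edge H e (Fin.suc Fin.zero)))
           Data.Nat.+ b2n (γ (edge H e (Fin.suc (Fin.suc Fin.zero)))))
  where import Data.Fin as Fin; import Data.Nat

IsMajority2Colouring : (H : Hypergraph3) → (Fin (n H) → Bool) → Set
IsMajority2Colouring H γ = ∀ e → ones H γ e ≡ 2

-- The monoid B₂¹ = {1, a, b, ab, ba, 0}; B₂ elements as matrix units
-- E i j (i,j ∈ Bool):  a = E true false, b = E false true,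
-- ab = E true true, ba = E false false.

data B21 : Set where
  one  : B21
  zro  : B21
  E    : Bool → Bool → B21

_≟B_ : Bool → Bool → Bool
true  ≟B true  = true
false ≟B false = true
_     ≟B _     = false

_·_ : B21 → B21 → B21
one   · y     = y
x     · one   = x
zro   · _     = zro
_     · zro   = zro
E i j · E k l with j ≟B k
... | true  = E i l
... | false = zro

Word : Set
Word = List ℕ

evalB : (ℕ → B21) → Word → B21
evalB σ []       = one
evalB σ (x ∷ xs) = σ x · evalB σ xs

B21⊨ : Word → Word → Set
B21⊨ w₁ w₂ = ∀ (σ : ℕ → B21) → evalB σ w₁ ≡ evalB σ w₂

-- The monoid M_H, given by its presentation: words over the generators
-- 0, t and the vertices, modulo the congruence generated by the relations.

data Gen (k : ℕ) : Set where
  g0  : Gen k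
  gt  : Gen k
  gv  : Fin k → Gen k

module _ (H : Hypergraph3) where
  private
    V = Fin (n H)
    G = Gen (n H)

  PairEquiv : V → V → V → V → Set
  PairEquiv u v x y =
      (Σ V λ w → IsEdge H u v w × IsEdge H x y w)
    ⊎ (¬ PairInEdge H u v × ¬ PairInEdge H x y)

  -- defining relations of M_H (the element e is u v w for any edge)
  data MRel : List G → List G → Set where
    zeroˡ  : ∀ g → MRel (g0 ∷ g ∷ []) (g0 ∷ [])
    zeroʳ  : ∀ g → MRel (g ∷ g0 ∷ []) (g0 ∷ [])
    tt     : MRel (gt ∷ gt ∷ []) (g0 ∷ [])
    tut    : ∀ u → MRel (gt ∷ gv u ∷ gt ∷ []) (g0 ∷ [])
    tuvt   : ∀ u v → MRel (gt ∷ gv u ∷ gv v ∷ gt ∷ []) (g0 ∷ [])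
    comm   : ∀ u v → MRel (gv u ∷ gv v ∷ []) (gv v ∷ gv u ∷ [])
    uu     : ∀ u → MRel (gv u ∷ gv u ∷ []) (g0 ∷ [])
    uv0    : ∀ u v → ¬ PairInEdge H u v → MRel (gv u ∷ gv v ∷ []) (g0 ∷ [])
    tuvwt  : ∀ u v w → IsEdge H u v w →
             MRel (gt ∷ gv u ∷ gv v ∷ gv w ∷ gt ∷ []) (gt ∷ [])
    eqE    : ∀ u v w u' v' w' → IsEdge H u v w → IsEdge H u' v' w' →
             MRel (gv u ∷ gv v ∷ gv w ∷ []) (gv u' ∷ gv v' ∷ gv w' ∷ [])
    ete    : ∀ u v w → IsEdge H u v w →
             MRel (gv u ∷ gv v ∷ gv w ∷ gt ∷ gv u ∷ gv v ∷ gv w ∷ [])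
                  (gv u ∷ gv v ∷ gv w ∷ [])
    pairEq : ∀ u v u' v' → ¬ u ≡ v → ¬ u' ≡ v' → PairEquiv u v u' v' →
             MRel (gv u ∷ gv v ∷ []) (gv u' ∷ gv v' ∷ [])

  data _∼_ : List G → List G → Set where
    rel   : ∀ p q x y → MRel x y → (p ++ x ++ q) ∼ (p ++ y ++ q)
    ∼refl : ∀ x → x ∼ x
    ∼sym  : ∀ {x y} → x ∼ y → y ∼ x
    ∼trans : ∀ {x y z} → x ∼ y → y ∼ z → x ∼ z

  M⊨ : Word → Word → Set
  M⊨ w₁ w₂ = ∀ (σ : ℕ → List G) → concatMap σ w₁ ∼ concatMap σ w₂

  -- M_H ∈ 𝔹₂¹ : M_H satisfies every identity of B₂¹ (Birkhoff)
  InB21Variety : Set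
  InB21Variety = ∀ w₁ w₂ → B21⊨ w₁ w₂ → M⊨ w₁ w₂

{-# OPTIONS --safe #-}

-- A cycle-free 3-uniform hypergraph has a leaf: an edge meeting the other edges in at most
-- one vertex (otherwise a walk through ever new edges would close a cycle). Colourings are
-- built by removing a leaf, colouring the rest with the prescribed values, and completing
-- the leaf so that it has exactly two vertices of colour 1; the only constraint is at the
-- vertex it shares, and two prescribed vertices of a common edge are never both 0.
--
-- Every element of M_H is 0, k or k t l, where a factor k is 1, a vertex u, a product u v
-- of two vertices of an edge (determined by the third vertex), or the idempotent e. A
-- majority colouring γ gives the assignment t ↦ a, u ↦ 1 or b according as γ u is 1 or 0;
-- the values of a word under these assignments are read off from its normal form, and the
-- colourings of the first part make them separate distinct normal forms. Hence two words
-- with equal values under all assignments into B₂¹ are equal in M_H, which applied to the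
-- substitution instances of an identity of B₂¹ gives M_H ∈ 𝔹₂¹.

module Submission where

open import Defs
open import Data.Bool using (Bool; true; false; not; _∧_; _∨_)
open import Data.Bool.Properties using (not-injective; ∨-comm; ∨-zeroʳ)
open import Data.Empty using (⊥; ⊥-elim)
open import Data.Fin using (Fin; toℕ)
open import Data.Fin.Patterns using (0F; 1F; 2F)
open import Data.Fin.Properties
  using (_≟_; any?; all?; ¬∀⟶∃¬; injective⇒≤; toℕ-injective; toℕ<n; toℕ-fromℕ<)
open import Data.List using (List; []; _∷_; _++_; length; filter; allFin; concatMap) renaming (lookup to lookupᴸ)
open import Data.List.Membership.Propositional using (_∈_; find; lose)
open import Data.List.Membership.Propositional.Properties using (∈-filter⁺; ∈-filter⁻; ∈-allFin)
open import Data.List.Properties using (filter-notAll; ++-assoc; ++-identityʳ)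
open import Data.List.Relation.Unary.Any using (Any; here; index) renaming (any? to anyᴸ?; map to mapᴬ)
open import Data.List.Relation.Unary.Any.Properties using (lookup-index)
open import Data.Maybe using (Maybe; just; nothing)
open import Data.Nat using (ℕ; zero; suc; _+_; _<_; _≤_; s≤s; z≤n)
open import Data.Nat.DivMod using (_%_; m<n⇒m%n≡m; n%n≡0)
open import Data.Nat.Properties
  using (anyUpTo?; ≤-refl; 1+n≰n; <-irrefl; ≤-pred; ≤-antisym; ≤-trans; <-trans; <-≤-trans; ≮⇒≥; _<?_;
         +-commutativeSemigroup)
open import Data.Product using (Σ; _×_; _,_; proj₁; proj₂)
open import Data.Sum using (_⊎_; inj₁; inj₂; [_,_]′; swap; assocʳ; assocˡ)
open import Data.Vec using (_∷_; []; lookup)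
open import Data.Vec.Relation.Unary.All using ([]; _∷_)
open import Data.Vec.Relation.Unary.AllPairs using ([]; _∷_)
open import Data.Vec.Relation.Unary.Unique.Propositional.Properties using (lookup-injective)
open import Function using (_∘_)
open import Relation.Binary.PropositionalEquality
open import Relation.Nullary using (¬_; Dec; yes; no)
open import Relation.Nullary.Decidable using (_×-dec_; _→-dec_; ¬?)
open import Algebra.Properties.CommutativeSemigroup +-commutativeSemigroup
  using (x∙yz≈x∙zy; x∙yz≈y∙xz; x∙yz≈y∙zx; x∙yz≈z∙xy; x∙yz≈z∙yx)

-- Positions in an edge

-- the position other than i and k (junk when i ≡ k)
third : Fin 3 → Fin 3 → Fin 3
third 0F 1F = 2F
third 0F 2F = 1F
third 1F 0F = 2F
third 1F 2F = 0F
third 2F 0F = 1F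
third 2F 1F = 0F
third i  _  = i

third-fresh : ∀ {i k} → i ≢ k → third i k ≢ i × third i k ≢ k
third-fresh {0F} {0F} i≢k = ⊥-elim (i≢k refl)
third-fresh {1F} {1F} i≢k = ⊥-elim (i≢k refl)
third-fresh {2F} {2F} i≢k = ⊥-elim (i≢k refl)
third-fresh {0F} {1F} _ = (λ ()) , (λ ())
third-fresh {0F} {2F} _ = (λ ()) , (λ ())
third-fresh {1F} {0F} _ = (λ ()) , (λ ())
third-fresh {1F} {2F} _ = (λ ()) , (λ ())
third-fresh {2F} {0F} _ = (λ ()) , (λ ())
third-fresh {2F} {1F} _ = (λ ()) , (λ ())

third-cover : ∀ {i k} → i ≢ k → ∀ j → j ≡ i ⊎ j ≡ k ⊎ j ≡ third i k
third-cover {0F} {0F} i≢k = ⊥-elim (i≢k refl)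
third-cover {1F} {1F} i≢k = ⊥-elim (i≢k refl)
third-cover {2F} {2F} i≢k = ⊥-elim (i≢k refl)
third-cover {0F} {1F} _ = λ { 0F → inj₁ refl ; 1F → inj₂ (inj₁ refl) ; 2F → inj₂ (inj₂ refl) }
third-cover {0F} {2F} _ = λ { 0F → inj₁ refl ; 2F → inj₂ (inj₁ refl) ; 1F → inj₂ (inj₂ refl) }
third-cover {1F} {0F} _ = λ { 1F → inj₁ refl ; 0F → inj₂ (inj₁ refl) ; 2F → inj₂ (inj₂ refl) }
third-cover {1F} {2F} _ = λ { 1F → inj₁ refl ; 2F → inj₂ (inj₁ refl) ; 0F → inj₂ (inj₂ refl) }
third-cover {2F} {0F} _ = λ { 2F → inj₁ refl ; 0F → inj₂ (inj₁ refl) ; 1F → inj₂ (inj₂ refl) }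
third-cover {2F} {1F} _ = λ { 2F → inj₁ refl ; 1F → inj₂ (inj₁ refl) ; 0F → inj₂ (inj₂ refl) }

other : Fin 3 → Fin 3
other 0F = 1F
other _  = 0F

other-≢ : ∀ i → i ≢ other i
other-≢ 0F ()
other-≢ 1F ()
other-≢ 2F ()

countOnes : (Fin 3 → Bool) → ℕ
countOnes t = b2n (t 0F) + (b2n (t 1F) + b2n (t 2F))

countOnes-third : ∀ t {i k} → i ≢ k →
                  countOnes t ≡ b2n (t i) + (b2n (t k) + b2n (t (third i k)))
countOnes-third t {0F} {0F} i≢k = ⊥-elim (i≢k refl)
countOnes-third t {1F} {1F} i≢k = ⊥-elim (i≢k refl)
countOnes-third t {2F} {2F} i≢k = ⊥-elim (i≢k refl)
countOnes-third t {0F} {1F} _ = refl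
countOnes-third t {0F} {2F} _ = x∙yz≈x∙zy (b2n (t 0F)) (b2n (t 1F)) (b2n (t 2F))
countOnes-third t {1F} {0F} _ = x∙yz≈y∙xz (b2n (t 0F)) (b2n (t 1F)) (b2n (t 2F))
countOnes-third t {1F} {2F} _ = x∙yz≈y∙zx (b2n (t 0F)) (b2n (t 1F)) (b2n (t 2F))
countOnes-third t {2F} {0F} _ = x∙yz≈z∙xy (b2n (t 0F)) (b2n (t 1F)) (b2n (t 2F))
countOnes-third t {2F} {1F} _ = x∙yz≈z∙yx (b2n (t 0F)) (b2n (t 1F)) (b2n (t 2F))

countOnes-cong : ∀ {t t′} → (∀ j → t j ≡ t′ j) → countOnes t ≡ countOnes t′
countOnes-cong t≗t′ = cong₂ _+_ (cong b2n (t≗t′ 0F)) (cong₂ _+_ (cong b2n (t≗t′ 1F)) (cong b2n (t≗t′ 2F)))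

majority-sum : ∀ p q → p ∨ q ≡ true → b2n p + (b2n q + b2n (not (p ∧ q))) ≡ 2
majority-sum true  true  _ = refl
majority-sum true  false _ = refl
majority-sum false true  _ = refl

fill : Fin 3 → Fin 3 → Bool → Bool → Fin 3 → Bool
fill i k p q j with j ≟ i | j ≟ k
... | yes _ | _     = p
... | no _  | yes _ = q
... | no _  | no _  = not (p ∧ q)

fill-at-i : ∀ i k p q → fill i k p q i ≡ p
fill-at-i i k p q with i ≟ i
... | yes _   = refl
... | no i≢i  = ⊥-elim (i≢i refl)

fill-at-k : ∀ {i k} p q → i ≢ k → fill i k p q k ≡ q
fill-at-k {i} {k} p q i≢k with k ≟ i | k ≟ k
... | yes k≡i | _       = ⊥-elim (i≢k (sym k≡i))
... | no _    | yes _   = refl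
... | no _    | no k≢k  = ⊥-elim (k≢k refl)

fill-at-third : ∀ {i k} p q → i ≢ k → fill i k p q (third i k) ≡ not (p ∧ q)
fill-at-third {i} {k} p q i≢k with third i k ≟ i | third i k ≟ k
... | yes t≡i | _       = ⊥-elim (proj₁ (third-fresh i≢k) t≡i)
... | no _    | yes t≡k = ⊥-elim (proj₂ (third-fresh i≢k) t≡k)
... | no _    | no _    = refl

countOnes-fill : ∀ {i k p q} → i ≢ k → p ∨ q ≡ true → countOnes (fill i k p q) ≡ 2
countOnes-fill {i} {k} {p} {q} i≢k p∨q = begin
  countOnes (fill i k p q)                                                    ≡⟨ countOnes-third (fill i k p q) i≢k ⟩
  b2n (fill i k p q i) + (b2n (fill i k p q k) + b2n (fill i k p q (third i k)))
    ≡⟨ cong₂ _+_ (cong b2n (fill-at-i i k p q))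
             (cong₂ _+_ (cong b2n (fill-at-k p q i≢k)) (cong b2n (fill-at-third p q i≢k))) ⟩
  b2n p + (b2n q + b2n (not (p ∧ q)))                                         ≡⟨ majority-sum p q p∨q ⟩
  2                                                                           ∎
  where open ≡-Reasoning

-- The monoid B₂¹

𝖺 𝖻 : B21
𝖺 = E true false
𝖻 = E false true

β : Bool → B21
β true  = one
β false = 𝖻

·-identityʳ : ∀ x → x · one ≡ x
·-identityʳ one     = refl
·-identityʳ zro     = refl
·-identityʳ (E _ _) = refl

·-zeroˡ : ∀ x → zro · x ≡ zro
·-zeroˡ one     = refl
·-zeroˡ zro     = refl
·-zeroˡ (E _ _) = refl

·-zeroʳ : ∀ x → x · zro ≡ zro
·-zeroʳ one     = refl
·-zeroʳ zro     = refl
·-zeroʳ (E _ _) = refl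

·-assoc : ∀ x y z → (x · y) · z ≡ x · (y · z)
·-assoc one     y       z       = refl
·-assoc zro     y       z       = trans (cong (_· z) (·-zeroˡ y)) (trans (·-zeroˡ z) (sym (·-zeroˡ (y · z))))
·-assoc (E i j) one     z       = refl
·-assoc (E i j) zro     z       = trans (·-zeroˡ z) (sym (trans (cong (E i j ·_) (·-zeroˡ z)) (·-zeroʳ (E i j))))
·-assoc (E i j) (E k l) one     = ·-identityʳ (E i j · E k l)
·-assoc (E i j) (E k l) zro     = ·-zeroʳ (E i j · E k l)
·-assoc (E _ true ) (E true  true ) (E true  _) = refl
·-assoc (E _ true ) (E true  true ) (E false _) = refl
·-assoc (E _ true ) (E true  false) (E true  _) = refl
·-assoc (E _ true ) (E true  false) (E false _) = refl
·-assoc (E _ true ) (E false true ) (E true  _) = refl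
·-assoc (E _ true ) (E false true ) (E false _) = refl
·-assoc (E _ true ) (E false false) (E true  _) = refl
·-assoc (E _ true ) (E false false) (E false _) = refl
·-assoc (E _ false) (E true  true ) (E true  _) = refl
·-assoc (E _ false) (E true  true ) (E false _) = refl
·-assoc (E _ false) (E true  false) (E true  _) = refl
·-assoc (E _ false) (E true  false) (E false _) = refl
·-assoc (E _ false) (E false true ) (E true  _) = refl
·-assoc (E _ false) (E false true ) (E false _) = refl
·-assoc (E _ false) (E false false) (E true  _) = refl
·-assoc (E _ false) (E false false) (E false _) = refl

β-injective : ∀ {p q} → β p ≡ β q → p ≡ q
β-injective {true}  {true}  _ = refl
β-injective {false} {false} _ = refl
β-injective {true}  {false} ()
β-injective {false} {true}  ()

β≢zro : ∀ p → β p ≢ zro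
β≢zro true  ()
β≢zro false ()

β·𝖺·β : ∀ p q → β p · (𝖺 · β q) ≡ E p (not q)
β·𝖺·β true  true  = refl
β·𝖺·β true  false = refl
β·𝖺·β false true  = refl
β·𝖺·β false false = refl

β·𝖺·β≢zro : ∀ p q → β p · (𝖺 · β q) ≢ zro
β·𝖺·β≢zro p q eq with trans (sym (β·𝖺·β p q)) eq
... | ()

E-injective : ∀ {i j k l} → E i j ≡ E k l → i ≡ k × j ≡ l
E-injective refl = refl , refl

β·𝖺·β-injective : ∀ p q p′ q′ → β p · (𝖺 · β q) ≡ β p′ · (𝖺 · β q′) → p ≡ p′ × q ≡ q′
β·𝖺·β-injective p q p′ q′ eq with E-injective (trans (sym (β·𝖺·β p q)) (trans eq (β·𝖺·β p′ q′)))
... | p≡p′ , ¬q≡¬q′ = p≡p′ , not-injective ¬q≡¬q′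

β·β-majority : ∀ p q r → b2n p + (b2n q + b2n r) ≡ 2 → β p · β q ≡ β (not r)
β·β-majority true  true  false _ = refl
β·β-majority true  false true  _ = refl
β·β-majority false true  true  _ = refl
β·β-majority true  true  true  ()
β·β-majority true  false false ()
β·β-majority false true  false ()
β·β-majority false false true  ()
β·β-majority false false false ()

β·β-not : ∀ p → β p · β (not p) ≡ 𝖻
β·β-not true  = refl
β·β-not false = refl

β·β-false : ∀ {p q} → p ≡ false → q ≡ false → β p · β q ≡ zro
β·β-false refl refl = refl

β≡β·𝖺·β : ∀ r p q → β r ≡ β p · (𝖺 · β q) → r ≡ false × p ≡ false × q ≡ false
β≡β·𝖺·β true  p q eq with trans eq (β·𝖺·β p q)
... | ()
β≡β·𝖺·β false p q eq with E-injective (trans eq (β·𝖺·β p q))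
... | f≡p , t≡¬q = refl , sym f≡p , not-injective (sym t≡¬q)

𝖺·𝖻·𝖺 : ∀ q → 𝖺 · (𝖻 · (𝖺 · β q)) ≡ 𝖺 · β q
𝖺·𝖻·𝖺 true  = refl
𝖺·𝖻·𝖺 false = refl

𝖺·𝖺 : ∀ q → 𝖺 · (𝖺 · β q) ≡ zro
𝖺·𝖺 true  = refl
𝖺·𝖺 false = refl

_◂_ : ∀ {A : Set} → A → (ℕ → A) → ℕ → A
(x ◂ f) zero    = x
(x ◂ f) (suc i) = f i

InjectiveBelow : ∀ {A : Set} → ℕ → (ℕ → A) → Set
InjectiveBelow L f = ∀ i j → i < L → j < L → f i ≡ f j → i ≡ j

◂-injectiveBelow : ∀ {A : Set} {L} {f : ℕ → A} {x} →
                   InjectiveBelow L f → (∀ i → i < L → f i ≢ x) → InjectiveBelow (suc L) (x ◂ f)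
◂-injectiveBelow f-inj x-fresh zero    zero    _         _         _  = refl
◂-injectiveBelow f-inj x-fresh zero    (suc j) _         (s≤s j<L) eq = ⊥-elim (x-fresh j j<L (sym eq))
◂-injectiveBelow f-inj x-fresh (suc i) zero    (s≤s i<L) _         eq = ⊥-elim (x-fresh i i<L eq)
◂-injectiveBelow f-inj x-fresh (suc i) (suc j) (s≤s i<L) (s≤s j<L) eq = cong suc (f-inj i j i<L j<L eq)

module Incidence (H : Hypergraph3) where
  private
    V = Fin (n H)
    Ed = Fin (m H)
    _∈ᵉ_ : V → Ed → Set
    v ∈ᵉ e = _∈ₑ_ H v e

  _∈ᵉ?_ : ∀ v e → Dec (v ∈ᵉ e)
  v ∈ᵉ? e = any? λ j → edge H e j ≟ v

  edge-≢ : ∀ e {i j} → i ≢ j → edge H e i ≢ edge H e j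
  edge-≢ e i≢j = i≢j ∘ edge-inj H e

  PairInEdge? : ∀ u v → Dec (PairInEdge H u v)
  PairInEdge? u v = any? λ e → u ∈ᵉ? e ×-dec v ∈ᵉ? e

  isEdge-at : ∀ e {i k} → i ≢ k → IsEdge H (edge H e i) (edge H e k) (edge H e (third i k))
  isEdge-at e {i} {k} i≢k = e , λ z → to z , from z
    where
    to : ∀ z → z ∈ᵉ e → z ≡ edge H e i ⊎ (z ≡ edge H e k ⊎ z ≡ edge H e (third i k))
    to z (j , refl) with third-cover i≢k j
    ... | inj₁ refl        = inj₁ refl
    ... | inj₂ (inj₁ refl) = inj₂ (inj₁ refl)
    ... | inj₂ (inj₂ refl) = inj₂ (inj₂ refl)
    from : ∀ z → z ≡ edge H e i ⊎ (z ≡ edge H e k ⊎ z ≡ edge H e (third i k)) → z ∈ᵉ e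
    from z (inj₁ refl)        = i , refl
    from z (inj₂ (inj₁ refl)) = k , refl
    from z (inj₂ (inj₂ refl)) = third i k , refl

  isEdge-rotate : ∀ {u v w} → IsEdge H u v w → IsEdge H v w u
  isEdge-rotate (e , e≈uvw) = e , λ z → assocʳ ∘ swap ∘ proj₁ (e≈uvw z) , proj₂ (e≈uvw z) ∘ swap ∘ assocˡ

module Cycles (H : Hypergraph3) where
  private
    V = Fin (n H)
    Ed = Fin (m H)
    _∈ᵉ_ : V → Ed → Set
    v ∈ᵉ e = _∈ₑ_ H v e

  record CyclicSequence (k : ℕ) : Set where
    field
      vertexAt : ℕ → V
      edgeAt   : ℕ → Ed
      vertexAt-injective : InjectiveBelow (suc (suc k)) vertexAt
      edgeAt-injective   : InjectiveBelow (suc (suc k)) edgeAt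
      link-here : ∀ i → i < suc k → vertexAt (suc i) ∈ᵉ edgeAt i
      link-next : ∀ i → i < suc k → vertexAt (suc i) ∈ᵉ edgeAt (suc i)
      close-here : vertexAt 0 ∈ᵉ edgeAt (suc k)
      close-next : vertexAt 0 ∈ᵉ edgeAt 0

  toℕ-next : ∀ {k} (c : Fin (suc (suc k))) →
              (suc (toℕ c) < suc (suc k) × toℕ (next c) ≡ suc (toℕ c)) ⊎ (toℕ c ≡ suc k × toℕ (next c) ≡ 0)
  toℕ-next {k} c with suc (toℕ c) <? suc (suc k)
  ... | yes c+1<L = inj₁ (c+1<L , trans (toℕ-fromℕ< _) (m<n⇒m%n≡m c+1<L))
  ... | no  c+1≮L = inj₂ (c≡k+1 , trans (toℕ-fromℕ< _) wraps)
    where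
    c≡k+1 : toℕ c ≡ suc k
    c≡k+1 = ≤-antisym (≤-pred (toℕ<n c)) (≤-pred (≮⇒≥ c+1≮L))
    wraps : suc (toℕ c) % suc (suc k) ≡ 0
    wraps = subst (λ x → suc x % suc (suc k) ≡ 0) (sym c≡k+1) (n%n≡0 (suc (suc k)))

  toCycle : ∀ {k} → CyclicSequence k → Cycle H k
  toCycle {k} C = record
    { vs     = λ c → vertexAt (toℕ c)
    ; es     = λ c → edgeAt (toℕ c)
    ; vs-inj = λ {c} {d} eq → toℕ-injective (vertexAt-injective _ _ (toℕ<n c) (toℕ<n d) eq)
    ; es-inj = λ {c} {d} eq → toℕ-injective (edgeAt-injective _ _ (toℕ<n c) (toℕ<n d) eq)
    ; link₁  = link₁
    ; link₂  = link₂
    }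
    where
    open CyclicSequence C
    link₁ : ∀ c → vertexAt (toℕ (next c)) ∈ᵉ edgeAt (toℕ c)
    link₁ c with toℕ-next c
    ... | inj₁ (c+1<L , eq) rewrite eq = link-here (toℕ c) (≤-pred c+1<L)
    ... | inj₂ (c≡k+1 , eq) rewrite eq | c≡k+1 = close-here
    link₂ : ∀ c → vertexAt (toℕ (next c)) ∈ᵉ edgeAt (toℕ (next c))
    link₂ c with toℕ-next c
    ... | inj₁ (c+1<L , eq) rewrite eq = link-next (toℕ c) (≤-pred c+1<L)
    ... | inj₂ (_ , eq) rewrite eq = close-next

  module _ (cf : CycleFree H) where

    no-digon : ∀ {x y g f} → x ≢ y → g ≢ f → x ∈ᵉ g → y ∈ᵉ g → x ∈ᵉ f → y ∈ᵉ f → ⊥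
    no-digon {x} {y} {g} {f} x≢y g≢f x∈g y∈g x∈f y∈f = cf 0 record
      { vs     = lookup (x ∷ y ∷ [])
      ; es     = lookup (g ∷ f ∷ [])
      ; vs-inj = λ {i} {j} → lookup-injective ((x≢y ∷ []) ∷ [] ∷ []) i j
      ; es-inj = λ {i} {j} → lookup-injective ((g≢f ∷ []) ∷ [] ∷ []) i j
      ; link₁  = λ { 0F → y∈g ; 1F → x∈f }
      ; link₂  = λ { 0F → y∈f ; 1F → x∈g }
      }

    no-triangle : ∀ {u x y g f h} → u ≢ x → u ≢ y → x ≢ y → g ≢ f → g ≢ h → f ≢ h →
                  u ∈ᵉ g → x ∈ᵉ g → x ∈ᵉ f → y ∈ᵉ f → y ∈ᵉ h → u ∈ᵉ h → ⊥
    no-triangle {u} {x} {y} {g} {f} {h} u≢x u≢y x≢y g≢f g≢h f≢h u∈g x∈g x∈f y∈f y∈h u∈h = cf 1 record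
      { vs     = lookup (u ∷ x ∷ y ∷ [])
      ; es     = lookup (g ∷ f ∷ h ∷ [])
      ; vs-inj = λ {i} {j} → lookup-injective ((u≢x ∷ u≢y ∷ []) ∷ (x≢y ∷ []) ∷ [] ∷ []) i j
      ; es-inj = λ {i} {j} → lookup-injective ((g≢f ∷ g≢h ∷ []) ∷ (f≢h ∷ []) ∷ [] ∷ []) i j
      ; link₁  = λ { 0F → x∈g ; 1F → y∈f ; 2F → u∈h }
      ; link₂  = λ { 0F → x∈f ; 1F → y∈h ; 2F → u∈g }
      }

    ¬PairInEdge-both : ∀ {u x y z} → IsEdge H x y z → x ≢ y → u ≢ x → u ≢ y → u ≢ z →
                       ¬ (PairInEdge H u x × PairInEdge H u y)
    ¬PairInEdge-both {u} {x} {y} (f , f≈xyz) x≢y u≢x u≢y u≢z ((g , u∈g , x∈g) , (h , u∈h , y∈h)) =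
      cycle (g ≟ h)
      where
      u∉f : ¬ u ∈ᵉ f
      u∉f u∈f = [ u≢x , [ u≢y , u≢z ]′ ]′ (proj₁ (f≈xyz u) u∈f)
      x∈f : x ∈ᵉ f
      x∈f = proj₂ (f≈xyz x) (inj₁ refl)
      y∈f : y ∈ᵉ f
      y∈f = proj₂ (f≈xyz y) (inj₂ (inj₁ refl))
      g≢f : g ≢ f
      g≢f refl = u∉f u∈g
      f≢h : f ≢ h
      f≢h refl = u∉f u∈h
      cycle : Dec (g ≡ h) → ⊥
      cycle (yes refl) = no-digon x≢y g≢f x∈g y∈h x∈f y∈f
      cycle (no g≢h)   = no-triangle u≢x u≢y x≢y g≢f g≢h f≢h u∈g x∈g x∈f y∈f y∈h u∈h

module Leaves (H : Hypergraph3) (cf : CycleFree H) where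
  open Incidence H using (_∈ᵉ?_)
  open Cycles H using (toCycle)
  private
    V = Fin (n H)
    Ed = Fin (m H)
    _∈ᵉ_ : V → Ed → Set
    v ∈ᵉ e = _∈ₑ_ H v e

  Shared : List Ed → Ed → Fin 3 → Set
  Shared S f j = Any (λ g → g ≢ f × edge H f j ∈ᵉ g) S

  Shared? : ∀ S f j → Dec (Shared S f j)
  Shared? S f j = anyᴸ? (λ g → ¬? (g ≟ f) ×-dec edge H f j ∈ᵉ? g) S

  Leaf : List Ed → Ed → Set
  Leaf S f = Σ (Fin 3) λ A → ∀ j → Shared S f j → j ≡ A

  Leaf? : ∀ S f → Dec (Leaf S f)
  Leaf? S f = any? λ A → all? λ j → Shared? S f j →-dec j ≟ A

  sharedAvoiding : ∀ {S f x} → ¬ Leaf S f → x ∈ᵉ f → Σ (Fin 3) λ j → Shared S f j × edge H f j ≢ x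
  sharedAvoiding {S} {f} ¬leaf (A , fA≡x) with ¬∀⟶∃¬ 3 _ (λ j → Shared? S f j →-dec j ≟ A) (λ all → ¬leaf (A , all))
  ... | j , ¬[shared⇒j≡A] with Shared? S f j
  ...   | no ¬shared = ⊥-elim (¬[shared⇒j≡A] (⊥-elim ∘ ¬shared))
  ...   | yes shared = j , shared , λ fj≡x → ¬[shared⇒j≡A] λ _ → edge-inj H f (trans fj≡x (sym fA≡x))

  record Path (S : List Ed) (L : ℕ) : Set where
    field
      vertexAt : ℕ → V
      edgeAt   : ℕ → Ed
      vertexAt-injective : InjectiveBelow L vertexAt
      edgeAt-injective   : InjectiveBelow L edgeAt
      vertex-here : ∀ i → i < L → vertexAt i ∈ᵉ edgeAt i
      vertex-next : ∀ i → suc i < L → vertexAt i ∈ᵉ edgeAt (suc i)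
      edgeAt∈S    : ∀ i → i < L → edgeAt i ∈ S

  module _ {S L} (P : Path S (suc L)) where
    open Path P

    closePath : ∀ k → suc k < suc L → ∀ z → z ∈ᵉ edgeAt (suc k) → z ∈ᵉ edgeAt 0 →
                (∀ j → j < suc k → vertexAt j ≢ z) → ⊥
    closePath k k+1<L z z∈last z∈first z-fresh = cf k (toCycle record
      { vertexAt           = z ◂ vertexAt
      ; edgeAt             = edgeAt
      ; vertexAt-injective = ◂-injectiveBelow (λ i j i< j< → vertexAt-injective i j (below i<) (below j<)) z-fresh
      ; edgeAt-injective   = λ i j i< j< → edgeAt-injective i j (≤-trans i< k+1<L) (≤-trans j< k+1<L)
      ; link-here          = λ i i< → vertex-here i (below i<)
      ; link-next          = λ i i< → vertex-next i (<-≤-trans (s≤s i<) k+1<L)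
      ; close-here         = z∈last
      ; close-next         = z∈first
      })
      where
      below : ∀ {i} → i < suc k → i < suc L
      below i< = <-trans i< k+1<L

    prepend : ∀ {y g} → y ∈ᵉ edgeAt 0 → y ≢ vertexAt 0 → g ∈ S → g ≢ edgeAt 0 → y ∈ᵉ g → Path S (suc (suc L))
    prepend {y} {g} y∈e₀ y≢x₀ g∈S g≢e₀ y∈g = checkVertices (anyUpTo? (λ i → vertexAt i ≟ y) (suc L))
      where
      checkEdges : (∀ {i} → i < suc L → vertexAt i ≢ y) → Dec (Σ ℕ λ i → i < suc L × edgeAt i ≡ g) → Path S (suc (suc L))
      checkEdges _       (yes (zero , _ , e₀≡g)) = ⊥-elim (g≢e₀ (sym e₀≡g))
      checkEdges y-fresh (yes (suc k , k+1<L , eₖ₊₁≡g)) =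
        ⊥-elim (closePath k k+1<L y (subst (y ∈ᵉ_) (sym eₖ₊₁≡g) y∈g) y∈e₀ λ i i< → y-fresh (<-trans i< k+1<L))
      checkEdges y-fresh (no g-fresh) = record
        { vertexAt           = y ◂ vertexAt
        ; edgeAt             = g ◂ edgeAt
        ; vertexAt-injective = ◂-injectiveBelow vertexAt-injective λ i i< → y-fresh i<
        ; edgeAt-injective   = ◂-injectiveBelow edgeAt-injective λ i i< eᵢ≡g → g-fresh (i , i< , eᵢ≡g)
        ; vertex-here        = λ { zero _ → y∈g  ; (suc i) (s≤s i<) → vertex-here i i< }
        ; vertex-next        = λ { zero _ → y∈e₀ ; (suc i) (s≤s i<) → vertex-next i i< }
        ; edgeAt∈S           = λ { zero _ → g∈S  ; (suc i) (s≤s i<) → edgeAt∈S i i< }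
        }
      checkVertices : Dec (Σ ℕ λ i → i < suc L × vertexAt i ≡ y) → Path S (suc (suc L))
      checkVertices (yes (zero , _ , x₀≡y)) = ⊥-elim (y≢x₀ (sym x₀≡y))
      checkVertices (yes (suc k , k+1<L , xₖ₊₁≡y)) =
        ⊥-elim (closePath k k+1<L y (subst (_∈ᵉ edgeAt (suc k)) xₖ₊₁≡y (vertex-here (suc k) k+1<L)) y∈e₀
                 λ i i<k+1 xᵢ≡y → <-irrefl (vertexAt-injective i (suc k) (<-trans i<k+1 k+1<L) k+1<L
                                                               (trans xᵢ≡y (sym xₖ₊₁≡y))) i<k+1)
      checkVertices (no y-fresh) =
        checkEdges (λ {i} i< xᵢ≡y → y-fresh (i , i< , xᵢ≡y)) (anyUpTo? (λ i → edgeAt i ≟ g) (suc L))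

    extend : (∀ f → f ∈ S → ¬ Leaf S f) → Path S (suc (suc L))
    extend noLeaf with sharedAvoiding (noLeaf (edgeAt 0) (edgeAt∈S 0 (s≤s z≤n))) (vertex-here 0 (s≤s z≤n))
    ... | j , shared , y≢x₀ with find shared
    ...   | g , g∈S , g≢e₀ , y∈g = prepend (j , refl) y≢x₀ g∈S g≢e₀ y∈g

  trivialPath : ∀ {S f} → f ∈ S → Path S 1
  trivialPath {f = f} f∈S = record
    { vertexAt           = λ _ → edge H f 0F
    ; edgeAt             = λ _ → f
    ; vertexAt-injective = injectiveBelow-1
    ; edgeAt-injective   = injectiveBelow-1
    ; vertex-here        = λ _ _ → 0F , refl
    ; vertex-next        = λ { _ (s≤s ()) }
    ; edgeAt∈S           = λ _ _ → f∈S
    }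
    where
    injectiveBelow-1 : ∀ {A : Set} {h : ℕ → A} → InjectiveBelow 1 h
    injectiveBelow-1 zero    zero    _         _         _ = refl
    injectiveBelow-1 (suc _) _       (s≤s ()) _          _
    injectiveBelow-1 zero    (suc _) _         (s≤s ()) _

  longPath : ∀ {S f} → (∀ f → f ∈ S → ¬ Leaf S f) → f ∈ S → ∀ L → Path S (suc L)
  longPath noLeaf f∈S zero    = trivialPath f∈S
  longPath noLeaf f∈S (suc L) = extend (longPath noLeaf f∈S L) noLeaf

  ¬Path-longer-than-edges : ∀ {S} → ¬ Path S (suc (length S))
  ¬Path-longer-than-edges {S} P = 1+n≰n (injective⇒≤ position-injective)
    where
    open Path P
    position : Fin (suc (length S)) → Fin (length S)
    position c = index (edgeAt∈S (toℕ c) (toℕ<n c))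
    position-injective : ∀ {c d} → position c ≡ position d → c ≡ d
    position-injective {c} {d} eq = toℕ-injective (edgeAt-injective (toℕ c) (toℕ d) (toℕ<n c) (toℕ<n d)
      (trans (lookup-index (edgeAt∈S (toℕ c) (toℕ<n c)))
             (trans (cong (lookupᴸ S) eq) (sym (lookup-index (edgeAt∈S (toℕ d) (toℕ<n d)))))))

  leaf-exists : ∀ {S f} → f ∈ S → Σ Ed λ g → g ∈ S × Leaf S g
  leaf-exists {S} f∈S with anyᴸ? (Leaf? S) S
  ... | yes someLeaf = find someLeaf
  ... | no  noLeaf   = ⊥-elim (¬Path-longer-than-edges (longPath (λ g g∈S leaf → noLeaf (lose g∈S leaf)) f∈S (length S)))

module Colouring (H : Hypergraph3) (cf : CycleFree H) where
  open Incidence H using (_∈ᵉ?_; edge-≢)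
  open Leaves H cf using (Leaf; leaf-exists)
  private
    V = Fin (n H)
    Ed = Fin (m H)
    _∈ᵉ_ : V → Ed → Set
    v ∈ᵉ e = _∈ₑ_ H v e

  MajorityOn : List Ed → (V → Bool) → Set
  MajorityOn S γ = ∀ g → g ∈ S → ones H γ g ≡ 2

  PairIn : List Ed → V → V → Set
  PairIn S u v = Σ Ed λ g → g ∈ S × u ∈ᵉ g × v ∈ᵉ g

  Admissible : List Ed → V → V → Bool → Bool → Set
  Admissible S u v p q = (u ≡ v → p ≡ q) × (u ≢ v → PairIn S u v → p ∨ q ≡ true)

  Prescribed : List Ed → V → V → Bool → Bool → Set
  Prescribed S u v p q = Σ (V → Bool) λ γ → MajorityOn S γ × γ u ≡ p × γ v ≡ q

  Prescribable : List Ed → Set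
  Prescribable S = ∀ {u v p q} → Admissible S u v p q → Prescribed S u v p q

  admissible-sym : ∀ {S u v p q} → Admissible S u v p q → Admissible S v u q p
  admissible-sym {p = p} {q} (u≡v⇒p≡q , paired⇒p∨q) =
    (λ v≡u → sym (u≡v⇒p≡q (sym v≡u))) ,
    λ { v≢u (g , g∈S , v∈g , u∈g) → trans (∨-comm q p) (paired⇒p∨q (v≢u ∘ sym) (g , g∈S , u∈g , v∈g)) }

  admissible-single : ∀ {S x c} → Admissible S x x c c
  admissible-single = (λ _ → refl) , λ x≢x → ⊥-elim (x≢x refl)

  prescribed-sym : ∀ {S u v p q} → Prescribed S u v p q → Prescribed S v u q p
  prescribed-sym (γ , γ-maj , γu , γv) = γ , γ-maj , γv , γu

  prescribable-[] : Prescribable []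
  prescribable-[] {u} {v} {p} {q} (u≡v⇒p≡q , _) = γ , (λ _ ()) , γ-at-u , γ-at-v
    where
    γ : V → Bool
    γ x with x ≟ u
    ... | yes _ = p
    ... | no _  = q
    γ-at-u : γ u ≡ p
    γ-at-u with u ≟ u
    ... | yes _   = refl
    ... | no u≢u  = ⊥-elim (u≢u refl)
    γ-at-v : γ v ≡ q
    γ-at-v with v ≟ u
    ... | yes v≡u = u≡v⇒p≡q (sym v≡u)
    ... | no _    = refl

  _∖_ : List Ed → Ed → List Ed
  S ∖ f = filter (λ g → ¬? (g ≟ f)) S

  ∈-∖⁺ : ∀ {S f g} → g ∈ S → g ≢ f → g ∈ S ∖ f
  ∈-∖⁺ {f = f} = ∈-filter⁺ (λ g → ¬? (g ≟ f))

  ∈-∖⁻ : ∀ {S f g} → g ∈ S ∖ f → g ∈ S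
  ∈-∖⁻ {f = f} = proj₁ ∘ ∈-filter⁻ (λ g → ¬? (g ≟ f))

  ∖-shorter : ∀ {S f} → f ∈ S → length (S ∖ f) < length S
  ∖-shorter {S} {f} f∈S = filter-notAll (λ g → ¬? (g ≟ f)) S (mapᴬ (λ f≡g g≢f → g≢f (sym f≡g)) f∈S)

  module PruneLeaf {S f} (f∈S : f ∈ S) (leaf : Leaf S f) (prescribable-rest : Prescribable (S ∖ f)) where
    A = proj₁ leaf

    overwrite : (Fin 3 → Bool) → (V → Bool) → V → Bool
    overwrite t γ x with x ∈ᵉ? f
    ... | yes (j , _) = t j
    ... | no _        = γ x

    overwrite-inside : ∀ t γ j → overwrite t γ (edge H f j) ≡ t j
    overwrite-inside t γ j with edge H f j ∈ᵉ? f
    ... | yes (j′ , fj′≡fj) = cong t (edge-inj H f fj′≡fj)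
    ... | no  fj∉f          = ⊥-elim (fj∉f (j , refl))

    overwrite-outside : ∀ t γ {x} → ¬ x ∈ᵉ f → overwrite t γ x ≡ γ x
    overwrite-outside t γ {x} x∉f with x ∈ᵉ? f
    ... | yes x∈f = ⊥-elim (x∉f x∈f)
    ... | no _    = refl

    overwrite-majority : ∀ t γ → countOnes t ≡ 2 → γ (edge H f A) ≡ t A → MajorityOn (S ∖ f) γ →
                         MajorityOn S (overwrite t γ)
    overwrite-majority t γ t-maj γA≡tA γ-maj g g∈S with g ≟ f
    ... | yes refl = trans (countOnes-cong (overwrite-inside t γ)) t-maj
    ... | no  g≢f  = trans (countOnes-cong agree) (γ-maj g (∈-∖⁺ g∈S g≢f))
      where
      agree : ∀ j → overwrite t γ (edge H g j) ≡ γ (edge H g j)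
      agree j with edge H g j ∈ᵉ? f
      ... | no _ = refl
      ... | yes (i , fi≡gj) with proj₂ leaf i (lose g∈S (g≢f , j , sym fi≡gj))
      ...   | refl = trans (sym γA≡tA) (cong γ fi≡gj)

    include : ∀ {u v} → PairIn (S ∖ f) u v → PairIn S u v
    include (g , g∈S∖f , u∈g , v∈g) = g , ∈-∖⁻ g∈S∖f , u∈g , v∈g

    restrict : ∀ {u v p q} → Admissible S u v p q → Admissible (S ∖ f) u v p q
    restrict (u≡v⇒p≡q , paired⇒p∨q) = u≡v⇒p≡q , λ u≢v → paired⇒p∨q u≢v ∘ include

    glue : ∀ t → countOnes t ≡ 2 → ∀ {y q} → Prescribed (S ∖ f) (edge H f A) y (t A) q →
           Σ (V → Bool) λ γ → MajorityOn S γ × (∀ j → γ (edge H f j) ≡ t j) × (¬ y ∈ᵉ f → γ y ≡ q)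
    glue t t-maj (γ , γ-maj , γA , γy) =
      overwrite t γ , overwrite-majority t γ t-maj γA γ-maj , overwrite-inside t γ ,
      λ y∉f → trans (overwrite-outside t γ y∉f) γy

    bothOutside : ∀ {u v p q} → ¬ u ∈ᵉ f → ¬ v ∈ᵉ f → Admissible S u v p q → Prescribed S u v p q
    bothOutside u∉f v∉f adm with prescribable-rest (restrict adm)
    ... | γ , γ-maj , γu , γv =
      overwrite t γ ,
      overwrite-majority t γ (countOnes-fill (other-≢ A) (∨-zeroʳ _)) (sym (fill-at-i A (other A) _ true)) γ-maj ,
      trans (overwrite-outside t γ u∉f) γu , trans (overwrite-outside t γ v∉f) γv
      where
      t = fill A (other A) (γ (edge H f A)) true

    oneInside : ∀ i {v p q} → ¬ v ∈ᵉ f → Admissible S (edge H f i) v p q → Prescribed S (edge H f i) v p q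
    oneInside i {v} {p} {q} v∉f (_ , paired⇒p∨q) with i ≟ A
    ... | yes refl with glue t (countOnes-fill (other-≢ A) (∨-zeroʳ p)) (prescribable-rest admissible)
      where
      t = fill A (other A) p true
      admissible : Admissible (S ∖ f) (edge H f A) v (t A) q
      admissible = (λ fA≡v → ⊥-elim (v∉f (A , fA≡v))) ,
                   λ fA≢v → subst (λ c → c ∨ q ≡ true) (sym (fill-at-i A (other A) p true)) ∘ paired⇒p∨q fA≢v ∘ include
    ...   | γ , γ-maj , γ-on-f , γ-off-f = γ , γ-maj , trans (γ-on-f A) (fill-at-i A (other A) p true) , γ-off-f v∉f
    oneInside i {v} {p} {q} v∉f _ | no i≢A with glue t (countOnes-fill i≢A (∨-zeroʳ p)) (prescribable-rest admissible)
      where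
      t = fill i A p true
      admissible : Admissible (S ∖ f) (edge H f A) v (t A) q
      admissible = (λ fA≡v → ⊥-elim (v∉f (A , fA≡v))) ,
                   λ _ _ → subst (λ c → c ∨ q ≡ true) (sym (fill-at-k p true i≢A)) refl
    ... | γ , γ-maj , γ-on-f , γ-off-f = γ , γ-maj , trans (γ-on-f i) (fill-at-i i A p true) , γ-off-f v∉f

    bothInside : ∀ i k {p q} → Admissible S (edge H f i) (edge H f k) p q → Prescribed S (edge H f i) (edge H f k) p q
    bothInside i k {p} {q} (u≡v⇒p≡q , _) with i ≟ k
    ... | yes refl with glue t (countOnes-fill (other-≢ i) (∨-zeroʳ p)) (prescribable-rest admissible-single)
      where
      t = fill i (other i) p true
    ...   | γ , γ-maj , γ-on-f , _ = γ , γ-maj , fi≡p , trans fi≡p (u≡v⇒p≡q refl)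
      where
      fi≡p = trans (γ-on-f i) (fill-at-i i (other i) p true)
    bothInside i k {p} {q} (_ , paired⇒p∨q) | no i≢k
      with glue t (countOnes-fill i≢k (paired⇒p∨q (edge-≢ f i≢k) (f , f∈S , (i , refl) , (k , refl))))
                  (prescribable-rest admissible-single)
      where
      t = fill i k p q
    ... | γ , γ-maj , γ-on-f , _ = γ , γ-maj , trans (γ-on-f i) (fill-at-i i k p q) , trans (γ-on-f k) (fill-at-k p q i≢k)

    prescribable : Prescribable S
    prescribable {u} {v} adm with u ∈ᵉ? f | v ∈ᵉ? f
    ... | no u∉f         | no v∉f         = bothOutside u∉f v∉f adm
    ... | yes (i , refl) | no v∉f         = oneInside i v∉f adm
    ... | no u∉f         | yes (k , refl) = prescribed-sym (oneInside k u∉f (admissible-sym adm))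
    ... | yes (i , refl) | yes (k , refl) = bothInside i k adm

  prescribable : ∀ S → Prescribable S
  prescribable S = byLength (length S) S ≤-refl
    where
    byLength : ∀ L S → length S ≤ L → Prescribable S
    byLength _       []      _     = prescribable-[]
    byLength (suc L) (g ∷ S) |S|≤L with leaf-exists (here refl)
    ... | f , f∈S , leaf =
      PruneLeaf.prescribable f∈S leaf (byLength L ((g ∷ S) ∖ f) (≤-pred (≤-trans (∖-shorter f∈S) |S|≤L)))

  Majority : (V → Bool) → Set
  Majority = IsMajority2Colouring H

  colouring₂ : ∀ {u v} p q → u ≢ v → (PairInEdge H u v → p ∨ q ≡ true) →
               Σ (V → Bool) λ γ → Majority γ × γ u ≡ p × γ v ≡ q
  colouring₂ p q u≢v paired⇒p∨q
    with prescribable (allFin (m H)) ((λ u≡v → ⊥-elim (u≢v u≡v)) ,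
                                      λ { _ (g , _ , u∈g , v∈g) → paired⇒p∨q (g , u∈g , v∈g) })
  ... | γ , γ-maj , γu , γv = γ , (λ g → γ-maj g (∈-allFin g)) , γu , γv

  colouring₁ : ∀ u c → Σ (V → Bool) λ γ → Majority γ × γ u ≡ c
  colouring₁ u c with prescribable (allFin (m H)) (admissible-single {x = u} {c})
  ... | γ , γ-maj , γu , _ = γ , (λ g → γ-maj g (∈-allFin g)) , γu

  colouring : Σ (V → Bool) Majority
  colouring = fromEdges (Fin? (m H))
    where
    Fin? : ∀ k → Dec (Fin k)
    Fin? zero    = no λ ()
    Fin? (suc k) = yes 0F
    fromEdges : Dec Ed → Σ (V → Bool) Majority
    fromEdges (no ¬edge) = (λ _ → true) , ⊥-elim ∘ ¬edge
    fromEdges (yes e) with colouring₁ (edge H e 0F) true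
    ... | γ , γ-maj , _ = γ , γ-maj

module Congruence (H : Hypergraph3) where
  private
    G = Gen (n H)

  infix  4 _~_
  infixr 2 _⟫_

  _~_ : List G → List G → Set
  _~_ = _∼_ H

  _⟫_ : ∀ {x y z} → x ~ y → y ~ z → x ~ z
  _⟫_ = ∼trans

  ~-cong : ∀ p q {x y} → x ~ y → (p ++ x ++ q) ~ (p ++ y ++ q)
  ~-cong p q (rel p′ q′ x y r) = subst₂ _~_ (reassoc x) (reassoc y) (rel (p ++ p′) (q′ ++ q) x y r)
    where
    reassoc : ∀ z → (p ++ p′) ++ z ++ q′ ++ q ≡ p ++ (p′ ++ z ++ q′) ++ q
    reassoc z = begin
      (p ++ p′) ++ z ++ q′ ++ q   ≡⟨ ++-assoc p p′ (z ++ q′ ++ q) ⟩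
      p ++ p′ ++ z ++ q′ ++ q     ≡⟨ cong (λ r → p ++ p′ ++ r) (++-assoc z q′ q) ⟨
      p ++ p′ ++ (z ++ q′) ++ q   ≡⟨ cong (p ++_) (++-assoc p′ (z ++ q′) q) ⟨
      p ++ (p′ ++ z ++ q′) ++ q   ∎
      where open ≡-Reasoning
  ~-cong p q (∼refl x)        = ∼refl _
  ~-cong p q (∼sym x~y)       = ∼sym (~-cong p q x~y)
  ~-cong p q (∼trans x~y y~z) = ∼trans (~-cong p q x~y) (~-cong p q y~z)

  ~-prefix : ∀ p {x y} → x ~ y → (p ++ x) ~ (p ++ y)
  ~-prefix p {x} {y} x~y = subst₂ _~_ (cong (p ++_) (++-identityʳ x)) (cong (p ++_) (++-identityʳ y)) (~-cong p [] x~y)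

  ~-suffix : ∀ q {x y} → x ~ y → (x ++ q) ~ (y ++ q)
  ~-suffix q = ~-cong [] q

  ~-cons : ∀ g {x y} → x ~ y → (g ∷ x) ~ (g ∷ y)
  ~-cons g = ~-prefix (g ∷ [])

  0-absorbsˡ : ∀ w → (g0 ∷ w) ~ (g0 ∷ [])
  0-absorbsˡ []      = ∼refl _
  0-absorbsˡ (g ∷ w) = rel [] w _ _ (zeroˡ g) ⟫ 0-absorbsˡ w

  0-absorbsʳ : ∀ p → (p ++ g0 ∷ []) ~ (g0 ∷ [])
  0-absorbsʳ []      = ∼refl _
  0-absorbsʳ (g ∷ p) = ~-cons g (0-absorbsʳ p) ⟫ rel [] [] _ _ (zeroʳ g)

module NormalForms (H : Hypergraph3) (cf : CycleFree H) where
  open ≡-Reasoning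
  open Incidence H using (edge-≢; PairInEdge?; isEdge-at; isEdge-rotate)
  open Cycles H using (¬PairInEdge-both)
  open Colouring H cf using (Majority; colouring; colouring₁; colouring₂)
  open Congruence H
  private
    V = Fin (n H)
    Ed = Fin (m H)
    G = Gen (n H)

  edgeOf : V → Ed
  edgeOf w = proj₁ (no-isolated H w)

  positionIn-edgeOf : V → Fin 3
  positionIn-edgeOf w = proj₁ (proj₂ (no-isolated H w))

  mate₁ mate₂ : V → V
  mate₁ w = edge H (edgeOf w) (other (positionIn-edgeOf w))
  mate₂ w = edge H (edgeOf w) (third (positionIn-edgeOf w) (other (positionIn-edgeOf w)))

  isEdge-mates : ∀ w → IsEdge H w (mate₁ w) (mate₂ w)
  isEdge-mates w = subst (λ x → IsEdge H x (mate₁ w) (mate₂ w)) (proj₂ (proj₂ (no-isolated H w)))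
                         (isEdge-at (edgeOf w) (other-≢ (positionIn-edgeOf w)))

  mate₁≢mate₂ : ∀ w → mate₁ w ≢ mate₂ w
  mate₁≢mate₂ w = edge-≢ (edgeOf w) (proj₂ (third-fresh (other-≢ (positionIn-edgeOf w))) ∘ sym)

  edgeWord : Ed → List G
  edgeWord f = gv (edge H f 0F) ∷ gv (edge H f 1F) ∷ gv (edge H f 2F) ∷ []

  isEdge-edgeWord : ∀ f → IsEdge H (edge H f 0F) (edge H f 1F) (edge H f 2F)
  isEdge-edgeWord f = isEdge-at f (λ ())

  vertex·pair≈0 : ∀ {u x y z} → IsEdge H x y z → x ≢ y → u ≢ z → (gv u ∷ gv x ∷ gv y ∷ []) ~ (g0 ∷ [])
  vertex·pair≈0 {u} {x} {y} xyz x≢y u≢z with u ≟ x | u ≟ y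
  ... | yes refl | _        = rel [] (gv y ∷ []) _ _ (uu u) ⟫ 0-absorbsˡ _
  ... | no _     | yes refl = rel [] (gv u ∷ []) _ _ (comm u x) ⟫ rel (gv x ∷ []) [] _ _ (uu u) ⟫ 0-absorbsʳ (gv x ∷ [])
  ... | no u≢x   | no u≢y with PairInEdge? u x | PairInEdge? u y
  ...   | no ux∉E  | _        = rel [] (gv y ∷ []) _ _ (uv0 u x ux∉E) ⟫ 0-absorbsˡ _
  ...   | yes _    | no uy∉E  =
    rel [] (gv y ∷ []) _ _ (comm u x) ⟫ rel (gv x ∷ []) [] _ _ (uv0 u y uy∉E) ⟫ 0-absorbsʳ (gv x ∷ [])
  ...   | yes ux∈E | yes uy∈E = ⊥-elim (¬PairInEdge-both cf xyz x≢y u≢x u≢y u≢z (ux∈E , uy∈E))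

  vertex·edge≈0 : ∀ u f → (gv u ∷ edgeWord f) ~ (g0 ∷ [])
  vertex·edge≈0 u f with u ≟ edge H f 0F
  ... | no u≢f₀   = rel [] (gv (edge H f 1F) ∷ gv (edge H f 2F) ∷ []) _ _ (comm u (edge H f 0F)) ⟫
                    ~-prefix (gv (edge H f 0F) ∷ [])
                             (vertex·pair≈0 (isEdge-rotate (isEdge-edgeWord f)) (edge-≢ f λ ()) u≢f₀)
                    ⟫ 0-absorbsʳ (gv (edge H f 0F) ∷ [])
  ... | yes refl  = ~-suffix (gv (edge H f 2F) ∷ []) (vertex·pair≈0 (isEdge-edgeWord f) (edge-≢ f λ ()) (edge-≢ f λ ()))
                    ⟫ 0-absorbsˡ (gv (edge H f 2F) ∷ [])

  -- opp w is u v for any edge {u, v, w}; the relations identify all these products.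
  data Factor : Set where
    ε   : Factor
    vtx : V → Factor
    opp : V → Factor
    tri : Ed → Factor

  ⌜_⌝ᶠ : Factor → List G
  ⌜ ε     ⌝ᶠ = []
  ⌜ vtx u ⌝ᶠ = gv u ∷ []
  ⌜ opp w ⌝ᶠ = gv (mate₁ w) ∷ gv (mate₂ w) ∷ []
  ⌜ tri f ⌝ᶠ = edgeWord f

  data Form : Set where
    ⟨_⟩   : Factor → Form
    _·t·_ : Factor → Factor → Form

  ⌜_⌝ : Maybe Form → List G
  ⌜ nothing        ⌝ = g0 ∷ []
  ⌜ just ⟨ k ⟩     ⌝ = ⌜ k ⌝ᶠ
  ⌜ just (k ·t· l) ⌝ = ⌜ k ⌝ᶠ ++ gt ∷ ⌜ l ⌝ᶠ

  eval : (G → B21) → List G → B21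
  eval σ []      = one
  eval σ (g ∷ w) = σ g · eval σ w

  τ : (V → Bool) → G → B21
  τ γ g0     = zro
  τ γ gt     = 𝖺
  τ γ (gv u) = β (γ u)

  χ : (V → Bool) → Factor → Bool
  χ γ ε       = true
  χ γ (vtx u) = γ u
  χ γ (opp w) = not (γ w)
  χ γ (tri _) = false

  value : (V → Bool) → Form → B21
  value γ ⟨ k ⟩     = β (χ γ k)
  value γ (k ·t· l) = β (χ γ k) · (𝖺 · β (χ γ l))

  -- τ γ is no morphism on M_H (u u ↦ 1 when γ u ≡ true), so a word equal to 0 is only
  -- known to vanish under some majority colouring.
  Describes : List G → Maybe Form → Set
  Describes x nothing  = Σ (V → Bool) λ γ → Majority γ × eval (τ γ) x ≡ zro
  Describes x (just c) = ∀ γ → Majority γ → eval (τ γ) x ≡ value γ c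

  NormalForm : List G → Set
  NormalForm x = Σ (Maybe Form) λ c → x ~ ⌜ c ⌝ × Describes x c

  pair-value : ∀ γ g {i k} → i ≢ k → Majority γ →
               β (γ (edge H g i)) · β (γ (edge H g k)) ≡ β (not (γ (edge H g (third i k))))
  pair-value γ g {i} {k} i≢k γ-maj =
    β·β-majority (γ (edge H g i)) (γ (edge H g k)) (γ (edge H g (third i k)))
                 (trans (sym (countOnes-third (λ j → γ (edge H g j)) i≢k)) (γ-maj g))

  VertexProduct : V → Factor → Set
  VertexProduct u k =
      (Σ Factor λ l → (gv u ∷ ⌜ k ⌝ᶠ) ~ ⌜ l ⌝ᶠ × (∀ γ → Majority γ → β (γ u) · β (χ γ k) ≡ β (χ γ l)))
    ⊎ ((gv u ∷ ⌜ k ⌝ᶠ) ~ (g0 ∷ []) × Σ (V → Bool) λ γ → Majority γ × β (γ u) · β (χ γ k) ≡ zro)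

  vertexProduct : ∀ u k → VertexProduct u k
  vertexProduct u ε = inj₁ (vtx u , ∼refl _ , λ γ _ → ·-identityʳ (β (γ u)))
  vertexProduct u (vtx v) with u ≟ v
  ... | yes refl with colouring₁ u false
  ...   | γ , γ-maj , γu≡0 = inj₂ (rel [] [] _ _ (uu u) , γ , γ-maj , β·β-false γu≡0 γu≡0)
  vertexProduct u (vtx v) | no u≢v with PairInEdge? u v
  ... | no uv∉E with colouring₂ false false u≢v (⊥-elim ∘ uv∉E)
  ...   | γ , γ-maj , γu≡0 , γv≡0 = inj₂ (rel [] [] _ _ (uv0 u v uv∉E) , γ , γ-maj , β·β-false γu≡0 γv≡0)
  vertexProduct _ (vtx _) | no u≢v | yes (g , (i , refl) , (k , refl)) =
    inj₁ (opp w ,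
          rel [] [] _ _ (pairEq _ _ _ _ u≢v (mate₁≢mate₂ w) (inj₁ (w , isEdge-at g i≢k , isEdge-rotate (isEdge-mates w)))) ,
          λ γ γ-maj → pair-value γ g i≢k γ-maj)
    where
    i≢k : i ≢ k
    i≢k = u≢v ∘ cong (edge H g)
    w = edge H g (third i k)
  vertexProduct u (opp w) with u ≟ w
  ... | yes refl = inj₁ (tri (edgeOf u) , rel [] [] _ _ (eqE _ _ _ _ _ _ (isEdge-mates u) (isEdge-edgeWord (edgeOf u))) ,
                         λ γ _ → β·β-not (γ u))
  ... | no u≢w with colouring₂ false true u≢w (λ _ → refl)
  ...   | γ , γ-maj , γu≡0 , γw≡1 =
          inj₂ (vertex·pair≈0 (isEdge-rotate (isEdge-mates w)) (mate₁≢mate₂ w) u≢w ,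
                γ , γ-maj , β·β-false γu≡0 (cong not γw≡1))
  vertexProduct u (tri f) with colouring₁ u false
  ... | γ , γ-maj , γu≡0 = inj₂ (vertex·edge≈0 u f , γ , γ-maj , β·β-false γu≡0 refl)

  tri? : ∀ k → (Σ Ed λ f → k ≡ tri f) ⊎ (∀ f → k ≢ tri f)
  tri? ε       = inj₂ λ _ ()
  tri? (vtx _) = inj₂ λ _ ()
  tri? (opp _) = inj₂ λ _ ()
  tri? (tri f) = inj₁ (f , refl)

  unit-colouring : ∀ k → (∀ f → k ≢ tri f) → Σ (V → Bool) λ γ → Majority γ × χ γ k ≡ true
  unit-colouring ε _ with colouring
  ... | γ , γ-maj = γ , γ-maj , refl
  unit-colouring (vtx v) _ with colouring₁ v true
  ... | γ , γ-maj , γv≡1 = γ , γ-maj , γv≡1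
  unit-colouring (opp w) _ with colouring₁ w false
  ... | γ , γ-maj , γw≡0 = γ , γ-maj , cong not γw≡0
  unit-colouring (tri f) k≢tri = ⊥-elim (k≢tri f refl)

  t·k·t≈0 : ∀ k → (∀ f → k ≢ tri f) → ∀ q → (gt ∷ ⌜ k ⌝ᶠ ++ gt ∷ q) ~ (g0 ∷ q)
  t·k·t≈0 ε       _     q = rel [] q _ _ tt
  t·k·t≈0 (vtx u) _     q = rel [] q _ _ (tut u)
  t·k·t≈0 (opp w) _     q = rel [] q _ _ (tuvt (mate₁ w) (mate₂ w))
  t·k·t≈0 (tri f) k≢tri = ⊥-elim (k≢tri f refl)

  t-∷ : ∀ c {x} → x ~ ⌜ just c ⌝ → Describes x (just c) → NormalForm (gt ∷ x)
  t-∷ ⟨ k ⟩ x~k x↦k = just (ε ·t· k) , ~-cons gt x~k , λ γ γ-maj → cong (𝖺 ·_) (x↦k γ γ-maj)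
  t-∷ (k ·t· l) x~kl x↦kl with tri? k
  ... | inj₁ (f , refl) =
    just (ε ·t· l) , (~-cons gt x~kl ⟫ rel [] ⌜ l ⌝ᶠ _ _ (tuvwt _ _ _ (isEdge-edgeWord f))) ,
    λ γ γ-maj → trans (cong (𝖺 ·_) (x↦kl γ γ-maj)) (𝖺·𝖻·𝖺 (χ γ l))
  ... | inj₂ k≢tri with unit-colouring k k≢tri
  ...   | γ , γ-maj , χk≡1 =
    nothing , (~-cons gt x~kl ⟫ t·k·t≈0 k k≢tri ⌜ l ⌝ᶠ ⟫ 0-absorbsˡ ⌜ l ⌝ᶠ) , γ , γ-maj ,
    trans (cong (𝖺 ·_) (trans (x↦kl γ γ-maj) (cong (λ b → β b · (𝖺 · β (χ γ l))) χk≡1))) (𝖺·𝖺 (χ γ l))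

  vertex-∷ : ∀ u c {x} → x ~ ⌜ just c ⌝ → Describes x (just c) → NormalForm (gv u ∷ x)
  vertex-∷ u ⟨ k ⟩ x~k x↦k with vertexProduct u k
  ... | inj₁ (l , uk~l , uk↦l) =
    just ⟨ l ⟩ , (~-cons (gv u) x~k ⟫ uk~l) , λ γ γ-maj → trans (cong (β (γ u) ·_) (x↦k γ γ-maj)) (uk↦l γ γ-maj)
  ... | inj₂ (uk~0 , γ , γ-maj , uk↦0) =
    nothing , (~-cons (gv u) x~k ⟫ uk~0) , γ , γ-maj , trans (cong (β (γ u) ·_) (x↦k γ γ-maj)) uk↦0
  vertex-∷ u (k ·t· l) {x} x~kl x↦kl with vertexProduct u k
  ... | inj₁ (k′ , uk~k′ , uk↦k′) =
    just (k′ ·t· l) , (~-cons (gv u) x~kl ⟫ ~-suffix (gt ∷ ⌜ l ⌝ᶠ) uk~k′) , λ γ γ-maj → begin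
      β (γ u) · eval (τ γ) x                     ≡⟨ cong (β (γ u) ·_) (x↦kl γ γ-maj) ⟩
      β (γ u) · (β (χ γ k) · (𝖺 · β (χ γ l)))    ≡⟨ ·-assoc (β (γ u)) _ _ ⟨
      (β (γ u) · β (χ γ k)) · (𝖺 · β (χ γ l))    ≡⟨ cong (_· (𝖺 · β (χ γ l))) (uk↦k′ γ γ-maj) ⟩
      β (χ γ k′) · (𝖺 · β (χ γ l))               ∎
  ... | inj₂ (uk~0 , γ , γ-maj , uk↦0) =
    nothing , (~-cons (gv u) x~kl ⟫ ~-suffix (gt ∷ ⌜ l ⌝ᶠ) uk~0 ⟫ 0-absorbsˡ _) , γ , γ-maj , (begin
      β (γ u) · eval (τ γ) x                     ≡⟨ cong (β (γ u) ·_) (x↦kl γ γ-maj) ⟩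
      β (γ u) · (β (χ γ k) · (𝖺 · β (χ γ l)))    ≡⟨ ·-assoc (β (γ u)) _ _ ⟨
      (β (γ u) · β (χ γ k)) · (𝖺 · β (χ γ l))    ≡⟨ cong (_· (𝖺 · β (χ γ l))) uk↦0 ⟩
      zro · (𝖺 · β (χ γ l))                      ≡⟨ ·-zeroˡ (𝖺 · β (χ γ l)) ⟩
      zro                                        ∎)

  normalForm-∷ : ∀ g {x} → NormalForm x → NormalForm (g ∷ x)
  normalForm-∷ g0 {x} _ with colouring
  ... | γ , γ-maj = nothing , 0-absorbsˡ x , γ , γ-maj , ·-zeroˡ (eval (τ γ) x)
  normalForm-∷ g (nothing , x~0 , γ , γ-maj , x↦0) =
    nothing , (~-cons g x~0 ⟫ rel [] [] _ _ (zeroʳ g)) , γ , γ-maj , trans (cong (τ γ g ·_) x↦0) (·-zeroʳ (τ γ g))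
  normalForm-∷ gt     (just c , x~c , x↦c) = t-∷ c x~c x↦c
  normalForm-∷ (gv u) (just c , x~c , x↦c) = vertex-∷ u c x~c x↦c

  normalForm : ∀ x → NormalForm x
  normalForm []      = just ⟨ ε ⟩ , ∼refl [] , λ _ _ → refl
  normalForm (g ∷ x) = normalForm-∷ g (normalForm x)

  Agree : Factor → Factor → Set
  Agree k l = ∀ γ → Majority γ → χ γ k ≡ χ γ l

  Separated : Factor → Factor → Set
  Separated k l = Σ (V → Bool) λ γ → Majority γ × χ γ k ≡ true × χ γ l ≡ false

  ¬agree : ∀ k l → Separated k l → ¬ Agree k l
  ¬agree _ _ (γ , γ-maj , χk≡1 , χl≡0) agree with trans (sym χk≡1) (trans (agree γ γ-maj) χl≡0)
  ... | ()

  ¬agree′ : ∀ k l → Separated l k → ¬ Agree k l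
  ¬agree′ k l sep agree = ¬agree l k sep λ γ γ-maj → sym (agree γ γ-maj)

  separated-ε : ∀ l → l ≢ ε → Separated ε l
  separated-ε ε       l≢ε = ⊥-elim (l≢ε refl)
  separated-ε (vtx v) _ with colouring₁ v false
  ... | γ , γ-maj , γv≡0 = γ , γ-maj , refl , γv≡0
  separated-ε (opp w) _ with colouring₁ w true
  ... | γ , γ-maj , γw≡1 = γ , γ-maj , refl , cong not γw≡1
  separated-ε (tri _) _ with colouring
  ... | γ , γ-maj = γ , γ-maj , refl , refl

  separated-tri : ∀ k f → (∀ f → k ≢ tri f) → Separated k (tri f)
  separated-tri k _ k≢tri with unit-colouring k k≢tri
  ... | γ , γ-maj , χk≡1 = γ , γ-maj , χk≡1 , refl

  separated-vtx-opp : ∀ u w → Separated (vtx u) (opp w)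
  separated-vtx-opp u w with u ≟ w
  ... | yes refl with colouring₁ u true
  ...   | γ , γ-maj , γu≡1 = γ , γ-maj , γu≡1 , cong not γu≡1
  separated-vtx-opp u w | no u≢w with colouring₂ true true u≢w (λ _ → refl)
  ... | γ , γ-maj , γu≡1 , γw≡1 = γ , γ-maj , γu≡1 , cong not γw≡1

  agree⇒~ : ∀ k l → Agree k l → ⌜ k ⌝ᶠ ~ ⌜ l ⌝ᶠ
  agree⇒~ ε       ε        _     = ∼refl []
  agree⇒~ k@(vtx u) l@(vtx v) agree with u ≟ v
  ... | yes refl = ∼refl _
  ... | no u≢v with colouring₂ true false u≢v (λ _ → refl)
  ...   | γ , γ-maj , γu≡1 , γv≡0 = ⊥-elim (¬agree k l (γ , γ-maj , γu≡1 , γv≡0) agree)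
  agree⇒~ k@(opp w) l@(opp w′) agree with w ≟ w′
  ... | yes refl = ∼refl _
  ... | no w≢w′ with colouring₂ false true w≢w′ (λ _ → refl)
  ...   | γ , γ-maj , γw≡0 , γw′≡1 = ⊥-elim (¬agree k l (γ , γ-maj , cong not γw≡0 , cong not γw′≡1) agree)
  agree⇒~ (tri f) (tri f′) _ = rel [] [] _ _ (eqE _ _ _ _ _ _ (isEdge-edgeWord f) (isEdge-edgeWord f′))
  agree⇒~ k@ε       l@(vtx _) agree = ⊥-elim (¬agree  k l (separated-ε l λ ()) agree)
  agree⇒~ k@ε       l@(opp _) agree = ⊥-elim (¬agree  k l (separated-ε l λ ()) agree)
  agree⇒~ k@ε       l@(tri _) agree = ⊥-elim (¬agree  k l (separated-ε l λ ()) agree)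
  agree⇒~ k@(vtx _) l@ε       agree = ⊥-elim (¬agree′ k l (separated-ε k λ ()) agree)
  agree⇒~ k@(opp _) l@ε       agree = ⊥-elim (¬agree′ k l (separated-ε k λ ()) agree)
  agree⇒~ k@(tri _) l@ε       agree = ⊥-elim (¬agree′ k l (separated-ε k λ ()) agree)
  agree⇒~ k@(vtx u) l@(opp w) agree = ⊥-elim (¬agree  k l (separated-vtx-opp u w) agree)
  agree⇒~ k@(opp w) l@(vtx u) agree = ⊥-elim (¬agree′ k l (separated-vtx-opp u w) agree)
  agree⇒~ k@(vtx _) l@(tri f) agree = ⊥-elim (¬agree  k l (separated-tri k f λ _ ()) agree)
  agree⇒~ k@(opp _) l@(tri f) agree = ⊥-elim (¬agree  k l (separated-tri k f λ _ ()) agree)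
  agree⇒~ k@(tri f) l@(vtx _) agree = ⊥-elim (¬agree′ k l (separated-tri l f λ _ ()) agree)
  agree⇒~ k@(tri f) l@(opp _) agree = ⊥-elim (¬agree′ k l (separated-tri l f λ _ ()) agree)

  never-false : ∀ k → (∀ f → k ≢ tri f) → ¬ (∀ γ → Majority γ → χ γ k ≡ false)
  never-false k k≢tri always with unit-colouring k k≢tri
  ... | γ , γ-maj , χk≡1 with trans (sym χk≡1) (always γ γ-maj)
  ...   | ()

  all-false : ∀ k l l′ → (∀ γ → Majority γ → value γ ⟨ k ⟩ ≡ value γ (l ·t· l′)) →
              ∀ γ → Majority γ → χ γ k ≡ false × χ γ l ≡ false × χ γ l′ ≡ false
  all-false k l l′ same γ γ-maj = β≡β·𝖺·β (χ γ k) (χ γ l) (χ γ l′) (same γ γ-maj)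

  plain≈tee : ∀ k l l′ → (∀ γ → Majority γ → value γ ⟨ k ⟩ ≡ value γ (l ·t· l′)) → ⌜ k ⌝ᶠ ~ ⌜ l ⌝ᶠ ++ gt ∷ ⌜ l′ ⌝ᶠ
  plain≈tee k l l′ same with tri? k | tri? l | tri? l′
  ... | inj₁ (f , refl) | inj₁ (g , refl) | inj₁ (g′ , refl) =
    agree⇒~ (tri f) (tri g) (λ _ _ → refl) ⟫
    ∼sym (rel [] [] _ _ (ete _ _ _ (isEdge-edgeWord g))) ⟫
    ~-prefix (edgeWord g) (~-cons gt (agree⇒~ (tri g) (tri g′) (λ _ _ → refl)))
  ... | inj₂ k≢tri | _          | _           = ⊥-elim (never-false k  k≢tri  λ γ → proj₁ ∘ all-false k l l′ same γ)
  ... | inj₁ _     | inj₂ l≢tri | _           = ⊥-elim (never-false l  l≢tri  λ γ → proj₁ ∘ proj₂ ∘ all-false k l l′ same γ)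
  ... | inj₁ _     | inj₁ _     | inj₂ l′≢tri = ⊥-elim (never-false l′ l′≢tri λ γ → proj₂ ∘ proj₂ ∘ all-false k l l′ same γ)

  values⇒~ : ∀ c d → (∀ γ → Majority γ → value γ c ≡ value γ d) → ⌜ just c ⌝ ~ ⌜ just d ⌝
  values⇒~ ⟨ k ⟩       ⟨ l ⟩       same = agree⇒~ k l λ γ γ-maj → β-injective (same γ γ-maj)
  values⇒~ ⟨ k ⟩       (l ·t· l′)  same = plain≈tee k l l′ same
  values⇒~ (k ·t· k′)  ⟨ l ⟩       same = ∼sym (plain≈tee l k k′ λ γ γ-maj → sym (same γ γ-maj))
  values⇒~ (k ·t· k′)  (l ·t· l′)  same =
    ~-suffix (gt ∷ ⌜ k′ ⌝ᶠ) (agree⇒~ k l λ γ γ-maj → proj₁ (factorwise γ γ-maj)) ⟫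
    ~-prefix ⌜ l ⌝ᶠ (~-cons gt (agree⇒~ k′ l′ λ γ γ-maj → proj₂ (factorwise γ γ-maj)))
    where
    factorwise : ∀ γ → Majority γ → χ γ k ≡ χ γ l × χ γ k′ ≡ χ γ l′
    factorwise γ γ-maj = β·𝖺·β-injective _ _ _ _ (same γ γ-maj)

  value≢zro : ∀ γ c → value γ c ≢ zro
  value≢zro γ ⟨ k ⟩     = β≢zro (χ γ k)
  value≢zro γ (k ·t· l) = β·𝖺·β≢zro (χ γ k) (χ γ l)

  describes⇒~ : ∀ {x y} c d → Describes x c → Describes y d → (∀ σ → eval σ x ≡ eval σ y) → ⌜ c ⌝ ~ ⌜ d ⌝
  describes⇒~ nothing  nothing  _                    _                    _    = ∼refl _
  describes⇒~ nothing  (just d) (γ , γ-maj , x↦0)   y↦d                  same =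
    ⊥-elim (value≢zro γ d (trans (sym (y↦d γ γ-maj)) (trans (sym (same (τ γ))) x↦0)))
  describes⇒~ (just c) nothing  x↦c                  (γ , γ-maj , y↦0)   same =
    ⊥-elim (value≢zro γ c (trans (sym (x↦c γ γ-maj)) (trans (same (τ γ)) y↦0)))
  describes⇒~ (just c) (just d) x↦c                  y↦d                  same =
    values⇒~ c d λ γ γ-maj → trans (sym (x↦c γ γ-maj)) (trans (same (τ γ)) (y↦d γ γ-maj))

  ~-of-evaluations : ∀ {x y} → (∀ σ → eval σ x ≡ eval σ y) → x ~ y
  ~-of-evaluations {x} {y} same with normalForm x | normalForm y
  ... | c , x~c , x↦c | d , y~d , y↦d = x~c ⟫ describes⇒~ c d x↦c y↦d same ⟫ ∼sym y~d

  eval-++ : ∀ σ a b → eval σ (a ++ b) ≡ eval σ a · eval σ b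
  eval-++ σ []      b = refl
  eval-++ σ (g ∷ a) b = trans (cong (σ g ·_) (eval-++ σ a b)) (sym (·-assoc (σ g) (eval σ a) (eval σ b)))

  eval-concatMap : ∀ σ (s : ℕ → List G) w → eval σ (concatMap s w) ≡ evalB (eval σ ∘ s) w
  eval-concatMap σ s []      = refl
  eval-concatMap σ s (i ∷ w) = trans (eval-++ σ (s i) (concatMap s w)) (cong (eval σ (s i) ·_) (eval-concatMap σ s w))

  inB21Variety : InB21Variety H
  inB21Variety w₁ w₂ B₂¹⊨w₁≈w₂ s = ~-of-evaluations λ σ →
    trans (eval-concatMap σ s w₁) (trans (B₂¹⊨w₁≈w₂ (eval σ ∘ s)) (sym (eval-concatMap σ s w₂)))

lemma2p11 : (H : Hypergraph3) → CycleFree H →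
    ((u v : Fin (n H)) → ¬ u ≡ v →
      Σ (Fin (n H) → Bool) λ γ₁ → Σ (Fin (n H) → Bool) λ γ₂ → Σ (Fin (n H) → Bool) λ γ₃ →
        IsMajority2Colouring H γ₁ × IsMajority2Colouring H γ₂ × IsMajority2Colouring H γ₃ ×
        (γ₁ u , γ₁ v) ≡ (true , true) × (γ₂ u , γ₂ v) ≡ (false , true) × (γ₃ u , γ₃ v) ≡ (true , false))
    × ((u v : Fin (n H)) → ¬ u ≡ v → ¬ PairInEdge H u v →
      Σ (Fin (n H) → Bool) λ γ → IsMajority2Colouring H γ × (γ u , γ v) ≡ (false , false))
    × InB21Variety H
lemma2p11 H cf =
  (λ u v u≢v →
    let γ₁ , maj₁ , at₁ = prescribe true  true  u≢v (λ _ → refl)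
        γ₂ , maj₂ , at₂ = prescribe false true  u≢v (λ _ → refl)
        γ₃ , maj₃ , at₃ = prescribe true  false u≢v (λ _ → refl)
    in γ₁ , γ₂ , γ₃ , maj₁ , maj₂ , maj₃ , at₁ , at₂ , at₃) ,
  (λ u v u≢v uv∉E → prescribe false false u≢v (⊥-elim ∘ uv∉E)) ,
  NormalForms.inB21Variety H cf
  where
  open Colouring H cf using (colouring₂)
  prescribe : ∀ {u v} p q → u ≢ v → (PairInEdge H u v → p ∨ q ≡ true) →
              Σ (Fin (n H) → Bool) λ γ → IsMajority2Colouring H γ × (γ u , γ v) ≡ (p , q)
  prescribe p q u≢v paired⇒p∨q with colouring₂ p q u≢v paired⇒p∨q
  ... | γ , γ-maj , γu≡p , γv≡q = γ , γ-maj , cong₂ _,_ γu≡p γv≡q
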